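{- Let $G$ be a finite simple graph such that no connected component of $G$ is a complete graph. Then $\gamma_{\rm gr}^{\rm Z}(G) \ge \gamma_t(G)$.
   Context: For a vertex $v$, $N(v)$ is its open neighborhood and $N[v]=N(v)\cup\{v\}$ its closed neighborhood. A set $D\subseteq V(G)$ is a total dominating set (TD-set) if every vertex of $G$ has a neighbor in $D$; $\gamma_t(G)$ is the minimum cardinality of a TD-set. A sequence $(v_1,\ldots,v_k)$ of distinct vertices of $G$ is a Z-sequence if for every $i\in\{1,\ldots,k\}$, $N(v_i)\setminus\bigcup_{j=1}^{i-1}N[v_j]\neq\emptyset$ (for $i=1$ this means $v_1$ has a neighbor). The Z-Grundy domination number $\gamma_{\rm gr}^{\rm Z}(G)$ is the maximum length of a Z-sequence in $G$. -}

module Defs where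

open import Data.Nat using (ℕ; _≤_)
open import Data.Fin using (Fin)
open import Data.Fin.Subset using (Subset; _∈_; _∉_; ∣_∣)
open import Data.List using (List; length; []; _∷_)
open import Data.Product using (Σ; ∃; _×_)
open import Relation.Binary.PropositionalEquality using (_≡_; _≢_)
open import Relation.Nullary using (¬_; Dec)
open import Data.Sum using (_⊎_)
open import Data.List.Membership.Propositional using () renaming (_∈_ to _∈ₗ_)

record Graph (n : ℕ) : Set₁ where
  field
    Adj    : Fin n → Fin n → Set
    adj?   : ∀ u v → Dec (Adj u v)
    sym    : ∀ {u v} → Adj u v → Adj v u
    irrefl : ∀ {u} → ¬ Adj u u
open Graph public

module _ {n : ℕ} (G : Graph n) where

  data Reach : Fin n → Fin n → Set where
    here  : ∀ {u} → Reach u u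
    step  : ∀ {u v w} → Adj G u v → Reach v w → Reach u w

  ComponentComplete : Fin n → Set
  ComponentComplete v = ∀ u w → Reach v u → Reach v w → u ≢ w → Adj G u w

  NoCompleteComponent : Set
  NoCompleteComponent = ∀ v → ¬ ComponentComplete v

  InN : Fin n → Fin n → Set
  InN v x = Adj G v x

  InNc : Fin n → Fin n → Set
  InNc v x = (x ≡ v) ⊎ Adj G v x

  IsTDSet : Subset n → Set
  IsTDSet D = ∀ v → ∃ λ u → (u ∈ D) × Adj G v u

  data Fresh (x : Fin n) : List (Fin n) → Set where
    []  : Fresh x []
    _∷_ : ∀ {v vs} → ¬ InNc v x → Fresh x vs → Fresh x (v ∷ vs)

  -- Z-sequence, stored in reverse: (v ∷ prev) is a Z-sequence iff prev is,
  -- v is not among prev, and N(v) \ ∪_{u ∈ prev} N[u] ≠ ∅.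
  data ZSeqRev : List (Fin n) → Set where
    []  : ZSeqRev []
    ext : ∀ {v prev} → ZSeqRev prev → ¬ (v ∈ₗ prev) →
          (∃ λ x → InN v x × Fresh x prev) → ZSeqRev (v ∷ prev)

  IsTotalDomNumber : ℕ → Set
  IsTotalDomNumber k =
    (∃ λ D → IsTDSet D × ∣ D ∣ ≡ k) × (∀ D → IsTDSet D → k ≤ ∣ D ∣)

  IsZGrundyNumber : ℕ → Set
  IsZGrundyNumber k =
    (∃ λ s → ZSeqRev s × length s ≡ k) × (∀ s → ZSeqRev s → length s ≤ k)

-- Grow a Z-sequence S greedily while keeping the invariant that every vertex
-- of the covered set C(S) = ⋃_{v ∈ S} N[v] has a neighbour in S.  While some
-- vertex is uncovered, either an edge wy leaves C(S) with w ∈ C(S), and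
-- appending w keeps both properties (y is new in N(w)); or the uncovered
-- vertices form a union of components, one of which is not complete and hence
-- contains an induced path a-b-c, and appending a and then b does.  A Z-sequence
-- has length at most γ_gr^Z, so the process stops with C(S) = V(G), and then the
-- vertices of S form a total dominating set of size at most γ_gr^Z.
module Submission where

open import Defs hiding (sym)
open import Data.Nat using (ℕ; _≤_; _<_; _+_; _∸_; s≤s; z≤n)
open import Data.Nat.Properties
  using (≤-refl; ≤-trans; ≤-reflexive; n≤1+n; +-suc; +-monoʳ-≤; ∸-monoʳ-<)
open import Data.Nat.Induction using (<-wellFounded)
open import Induction.WellFounded using (Acc; acc)
open import Data.Fin using (Fin) renaming (_≟_ to _≟ᶠ_)
open import Data.Fin.Properties using (any?; all?; ¬∀⟶∃¬)
open import Data.Fin.Subset using (Subset; ⁅_⁆; _∪_; ⊥; inside; outside; ∣_∣) renaming (_∈_ to _∈ˢ_)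
open import Data.Fin.Subset.Properties using (x∈⁅x⁆; p⊆p∪q; q⊆p∪q; ∣⊥∣≡0; ∣⁅x⁆∣≡1; ∣p∣≤∣x∷p∣)
open import Data.List using (List; []; _∷_; length)
open import Data.List.Relation.Unary.Any as Any using (Any; here; there)
open import Data.List.Membership.Propositional using () renaming (_∈_ to _∈ₗ_)
open import Data.Vec using (_∷_; [])
open import Data.Product using (∃; ∃₂; _×_; _,_)
open import Data.Sum using (_⊎_; inj₁; inj₂)
open import Data.Empty using (⊥-elim)
open import Relation.Nullary using (¬_; Dec; yes; no)
open import Relation.Nullary.Decidable using (_×-dec_; _⊎-dec_; ¬?)
open import Relation.Binary.PropositionalEquality using (_≢_; refl; sym; cong)

∣p∪q∣≤∣p∣+∣q∣ : ∀ {m} (p q : Subset m) → ∣ p ∪ q ∣ ≤ ∣ p ∣ + ∣ q ∣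
∣p∪q∣≤∣p∣+∣q∣ []            []            = z≤n
∣p∪q∣≤∣p∣+∣q∣ (inside  ∷ p) (t       ∷ q) =
  s≤s (≤-trans (∣p∪q∣≤∣p∣+∣q∣ p q) (+-monoʳ-≤ ∣ p ∣ (∣p∣≤∣x∷p∣ t q)))
∣p∪q∣≤∣p∣+∣q∣ (outside ∷ p) (inside  ∷ q) =
  ≤-trans (s≤s (∣p∪q∣≤∣p∣+∣q∣ p q)) (≤-reflexive (sym (+-suc ∣ p ∣ ∣ q ∣)))
∣p∪q∣≤∣p∣+∣q∣ (outside ∷ p) (outside ∷ q) = ∣p∪q∣≤∣p∣+∣q∣ p q

toSubset : ∀ {m} → List (Fin m) → Subset m
toSubset []       = ⊥
toSubset (x ∷ xs) = ⁅ x ⁆ ∪ toSubset xs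

∈⇒∈toSubset : ∀ {m} {x : Fin m} {xs} → x ∈ₗ xs → x ∈ˢ toSubset xs
∈⇒∈toSubset {x = x} {_ ∷ xs} (here refl) = p⊆p∪q (toSubset xs) (x∈⁅x⁆ x)
∈⇒∈toSubset {xs = y ∷ xs}    (there x∈xs) = q⊆p∪q ⁅ y ⁆ (toSubset xs) (∈⇒∈toSubset x∈xs)

∣toSubset∣≤length : ∀ {m} (xs : List (Fin m)) → ∣ toSubset xs ∣ ≤ length xs
∣toSubset∣≤length {m} []       = ≤-reflexive (∣⊥∣≡0 m)
∣toSubset∣≤length     (x ∷ xs) = ≤-trans (∣p∪q∣≤∣p∣+∣q∣ ⁅ x ⁆ (toSubset xs))
  (≤-trans (≤-reflexive (cong (_+ _) (∣⁅x⁆∣≡1 x))) (s≤s (∣toSubset∣≤length xs)))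

grow-until : ∀ {A : Set} {P Q : List A → Set} (bound : ℕ) →
             (∀ {s} → P s → length s ≤ bound) →
             (∀ {s} → P s → Q s ⊎ ∃ λ s′ → P s′ × length s < length s′) →
             ∀ {s} → P s → ∃ λ s → P s × Q s
grow-until {P = P} {Q} bound bounded extend Ps = go Ps (<-wellFounded _)
  where
  go : ∀ {s} → P s → Acc _<_ (bound ∸ length s) → ∃ λ s → P s × Q s
  go {s} Ps (acc rs) with extend Ps
  ... | inj₁ Qs                 = s , Ps , Qs
  ... | inj₂ (s′ , Ps′ , longer) = go Ps′ (rs (∸-monoʳ-< longer (bounded Ps′)))

module _ {n : ℕ} (G : Graph n) where

  Reach-trans : ∀ {u v w} → Reach G u v → Reach G v w → Reach G u w
  Reach-trans here         r′ = r′
  Reach-trans (step uv r) r′ = step uv (Reach-trans r r′)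

  Reach-sym : ∀ {u v} → Reach G u v → Reach G v u
  Reach-sym here        = here
  Reach-sym (step uv r) = Reach-trans (Reach-sym r) (step (Graph.sym G uv) here)

  InducedP₃ : Fin n → Fin n → Fin n → Set
  InducedP₃ a b c = Adj G a b × Adj G b c × a ≢ c × ¬ Adj G a c

  InducedP₃? : ∀ a b c → Dec (InducedP₃ a b c)
  InducedP₃? a b c = adj? G a b ×-dec adj? G b c ×-dec ¬? (a ≟ᶠ c) ×-dec ¬? (adj? G a c)

  -- The first vertex r of the walk that is adjacent to q gives the induced
  -- path (predecessor of r) - r - q.
  walk⇒InducedP₃ : ∀ {p q} → Reach G p q → p ≢ q → ¬ Adj G p q →
                   ∃₂ λ a b → ∃ λ c → Reach G p a × Reach G p b × Reach G p c × InducedP₃ a b c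
  walk⇒InducedP₃         here          p≢q _ = ⊥-elim (p≢q refl)
  walk⇒InducedP₃ {p} {q} (step {v = r} pr r↝q) p≢q ¬pq with r ≟ᶠ q
  ... | yes refl = ⊥-elim (¬pq pr)
  ... | no r≢q with adj? G r q
  ...   | yes rq = p , r , q , here , step pr here , step pr r↝q , pr , rq , p≢q , ¬pq
  ...   | no ¬rq with walk⇒InducedP₃ r↝q r≢q ¬rq
  ...     | a , b , c , r↝a , r↝b , r↝c , abc =
              a , b , c , step pr r↝a , step pr r↝b , step pr r↝c , abc

  P₃-free⇒ComponentComplete : ∀ u →
    (∀ {a b c} → Reach G u a → Reach G u b → Reach G u c → ¬ InducedP₃ a b c) →
    ComponentComplete G u
  P₃-free⇒ComponentComplete u noP₃ p q u↝p u↝q p≢q with adj? G p q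
  ... | yes pq = pq
  ... | no ¬pq with walk⇒InducedP₃ (Reach-trans (Reach-sym u↝p) u↝q) p≢q ¬pq
  ...   | a , b , c , p↝a , p↝b , p↝c , abc =
          ⊥-elim (noP₃ (Reach-trans u↝p p↝a) (Reach-trans u↝p p↝b) (Reach-trans u↝p p↝c) abc)

  Covered : List (Fin n) → Fin n → Set
  Covered S x = Any (λ v → InNc G v x) S

  covered? : ∀ S x → Dec (Covered S x)
  covered? S x = Any.any? (λ v → (x ≟ᶠ v) ⊎-dec adj? G v x) S

  ∈⇒Covered : ∀ {S x} → x ∈ₗ S → Covered S x
  ∈⇒Covered = Any.map λ { refl → inj₁ refl }

  ¬Covered⇒Fresh : ∀ {x} S → ¬ Covered S x → Fresh G x S
  ¬Covered⇒Fresh []      _      = []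
  ¬Covered⇒Fresh (v ∷ S) x∉C = (λ x∈ → x∉C (here x∈)) ∷ ¬Covered⇒Fresh S (λ x∈ → x∉C (there x∈))

  TotallyDominatesCovered : List (Fin n) → Set
  TotallyDominatesCovered S = ∀ x → Covered S x → ∃ λ s → s ∈ₗ S × Adj G x s

  Admissible : List (Fin n) → Set
  Admissible S = ZSeqRev G S × TotallyDominatesCovered S

  Admissible[] : Admissible []
  Admissible[] = [] , λ _ ()

  allCovered⇒IsTDSet : ∀ {S} → TotallyDominatesCovered S → (∀ x → Covered S x) →
                       IsTDSet G (toSubset S)
  allCovered⇒IsTDSet dom all v with dom v (all v)
  ... | s , s∈S , vs = s , ∈⇒∈toSubset s∈S , vs

  Boundary : List (Fin n) → Set
  Boundary S = ∃₂ λ w y → Covered S w × Adj G w y × ¬ Covered S y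

  boundary? : ∀ S → Dec (Boundary S)
  boundary? S = any? λ w → any? λ y → covered? S w ×-dec adj? G w y ×-dec ¬? (covered? S y)

  ¬Boundary⇒uncovered-Reach-closed : ∀ {S u v} → ¬ Boundary S → ¬ Covered S u →
                                     Reach G u v → ¬ Covered S v
  ¬Boundary⇒uncovered-Reach-closed ¬bd u∉C here = u∉C
  ¬Boundary⇒uncovered-Reach-closed ¬bd u∉C (step ur r↝v) = ¬Boundary⇒uncovered-Reach-closed ¬bd
    (λ r∈C → ¬bd (_ , _ , r∈C , Graph.sym G ur , u∉C)) r↝v

  UncoveredP₃ : List (Fin n) → Set
  UncoveredP₃ S = ∃₂ λ a b → ∃ λ c →
    ¬ Covered S a × ¬ Covered S b × ¬ Covered S c × InducedP₃ a b c

  uncoveredP₃? : ∀ S → Dec (UncoveredP₃ S)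
  uncoveredP₃? S = any? λ a → any? λ b → any? λ c →
    ¬? (covered? S a) ×-dec ¬? (covered? S b) ×-dec ¬? (covered? S c) ×-dec InducedP₃? a b c

  extend-at-boundary : ∀ {S w y} → Admissible S →
                       Covered S w → Adj G w y → ¬ Covered S y → Admissible (w ∷ S)
  extend-at-boundary {S} {w} (zs , dom) w∈C wy y∉C =
    ext zs w∉S (_ , wy , ¬Covered⇒Fresh S y∉C) , dom′
    where
    w∉S : ¬ (w ∈ₗ S)
    w∉S w∈S = y∉C (Any.map (λ { refl → inj₂ wy }) w∈S)
    dom′ : TotallyDominatesCovered (w ∷ S)
    dom′ x (here (inj₁ refl)) with dom w w∈C
    ... | s , s∈S , ws = s , there s∈S , ws
    dom′ x (here (inj₂ wx)) = w , here refl , Graph.sym G wx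
    dom′ x (there x∈C) with dom x x∈C
    ... | s , s∈S , xs = s , there s∈S , xs

  -- c witnesses that b is a valid next term, and b (resp. a) dominates the
  -- newly covered vertices of N[a] (resp. N[b]).
  extend-by-P₃ : ∀ {S a b c} → Admissible S →
                 ¬ Covered S a → ¬ Covered S b → ¬ Covered S c → InducedP₃ a b c →
                 Admissible (b ∷ a ∷ S)
  extend-by-P₃ {S} {a} {b} {c} (zs , dom) a∉C b∉C c∉C (ab , bc , a≢c , ¬ac) =
    ext (ext zs (λ a∈S → a∉C (∈⇒Covered a∈S)) (b , ab , ¬Covered⇒Fresh S b∉C))
        b∉aS (c , bc , ¬Covered⇒Fresh (a ∷ S) c∉C′) ,
    dom′
    where
    b∉aS : ¬ (b ∈ₗ a ∷ S)
    b∉aS (here refl) = Graph.irrefl G ab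
    b∉aS (there b∈S) = b∉C (∈⇒Covered b∈S)
    c∉C′ : ¬ Covered (a ∷ S) c
    c∉C′ (here (inj₁ refl)) = a≢c refl
    c∉C′ (here (inj₂ ac))  = ¬ac ac
    c∉C′ (there c∈C)       = c∉C c∈C
    dom′ : TotallyDominatesCovered (b ∷ a ∷ S)
    dom′ x (here (inj₁ refl))         = a , there (here refl) , Graph.sym G ab
    dom′ x (here (inj₂ bx))           = b , here refl , Graph.sym G bx
    dom′ x (there (here (inj₁ refl))) = b , here refl , ab
    dom′ x (there (here (inj₂ ax)))   = a , there (here refl) , Graph.sym G ax
    dom′ x (there (there x∈C)) with dom x x∈C
    ... | s , s∈S , xs = s , there (there s∈S) , xs

  Admissible-extends : NoCompleteComponent G → ∀ {S} → Admissible S →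
    (∀ x → Covered S x) ⊎ ∃ λ S′ → Admissible S′ × length S < length S′
  Admissible-extends ncc {S} adm with all? (covered? S)
  ... | yes all = inj₁ all
  ... | no ¬all with ¬∀⟶∃¬ n (Covered S) (covered? S) ¬all | boundary? S
  ...   | _ , _ | yes (w , y , w∈C , wy , y∉C) =
          inj₂ (w ∷ S , extend-at-boundary adm w∈C wy y∉C , ≤-refl)
  ...   | u , u∉C | no ¬bd with uncoveredP₃? S
  ...     | yes (a , b , c , a∉C , b∉C , c∉C , abc) =
            inj₂ (b ∷ a ∷ S , extend-by-P₃ adm a∉C b∉C c∉C abc , s≤s (n≤1+n _))
  ...     | no ¬P₃ = ⊥-elim (ncc u (P₃-free⇒ComponentComplete u λ u↝a u↝b u↝c abc →
              ¬P₃ (_ , _ , _ , uncovered u↝a , uncovered u↝b , uncovered u↝c , abc)))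
    where
    uncovered : ∀ {v} → Reach G u v → ¬ Covered S v
    uncovered = ¬Boundary⇒uncovered-Reach-closed ¬bd u∉C

theorem3p2 : ∀ {n : ℕ} (G : Graph n) → NoCompleteComponent G →
    ∀ (z t : ℕ) → IsZGrundyNumber G z → IsTotalDomNumber G t → t ≤ z
theorem3p2 G ncc z t (_ , z-max) (_ , t-min)
  with grow-until z (λ {S} (zs , _) → z-max S zs) (Admissible-extends G ncc) (Admissible[] G)
... | S , (zs , dom) , all =
  ≤-trans (t-min (toSubset S) (allCovered⇒IsTDSet G dom all))
          (≤-trans (∣toSubset∣≤length S) (z-max S zs))
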